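{- Let $\Theta_1,\Theta_2\in S_n^3$ be such that the cycle structure of $\Theta_1$ is obtained from that of $\Theta_2$ by permuting its three components. Then $|C_{\Theta_1,s}|=|C_{\Theta_2,s}|$ for all $s\in[n^2]$. Consequently, $|C_{\Theta_1}|=|C_{\Theta_2}|$.
   Context: A Latin square of order $n$ is an $n\times n$ array over $[n]$ with each symbol exactly once in each row and column; a partial Latin square of order $n$ is an $n\times n$ array whose cells are empty or contain a symbol of $[n]$, each symbol at most once per row and column (non-empty: some cell filled). $O(P)$ is the set of (row, column, symbol) triples of filled cells; the size of $P$ is $|O(P)|$. For $\Theta=(\alpha,\beta,\gamma)\in S_n^3$, $\Theta$ is an autotopism of $P$ if $\{(\alpha(r),\beta(c),\gamma(s)):(r,c,s)\in O(P)\}=O(P)$. The cycle structure of $\Theta$ is the triple of cycle structures of $\alpha,\beta,\gamma$. A non-empty partial Latin square $P$ having $\Theta$ as autotopism is $\Theta$-completable if there is a Latin square $L$ having $\Theta$ as autotopism with $O(P)\subseteq O(L)$. $C_\Theta$ is the set of $\Theta$-completable partial Latin squares and $C_{\Theta,s}$ the subset of those of size $s$. -}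

module Defs where

open import Data.Nat using (ℕ; zero; suc; _+_; _*_; _≤_)
open import Data.Nat.DivMod using (_/_)
open import Data.Fin using (Fin; toℕ; _≟_)
import Data.Fin as Fin
import Data.Nat
open import Data.Fin.Permutation using (Permutation′; _⟨$⟩ʳ_)
open import Data.Vec using (Vec; lookup; tabulate; map)
open import Data.List using (List; filterᵇ; length; allFin) renaming (map to lmap)
open import Data.Nat.ListAction using (sum)

open import Data.Maybe using (Maybe; just; nothing; is-just)
open import Data.Bool using (Bool; true; false)
open import Data.Product using (Σ; ∃; _×_; _,_)
open import Data.Refinement using (Refinement)
open import Relation.Nullary using (yes; no; does)
open import Relation.Binary.PropositionalEquality using (_≡_)
open import Function using (_↔_)

-- findPeriod f x y k fuel : here y = f^k x; returns the least such k ≥ (initial k)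
-- with f^k x ≡ x (fuel n suffices since the period of a permutation is ≤ n).
findPeriod : ∀ {n} → (Fin n → Fin n) → Fin n → Fin n → ℕ → ℕ → ℕ
findPeriod f x y k fuel with y ≟ x
... | yes _ = k
findPeriod f x y k zero    | no _ = k
findPeriod f x y k (suc m) | no _ = findPeriod f x (f y) (suc k) m

cycleLength : ∀ {n} → Permutation′ n → Fin n → ℕ
cycleLength {n} α x = findPeriod (α ⟨$⟩ʳ_) x (α ⟨$⟩ʳ x) 1 n

pointsInCyclesOfLength : ∀ {n} → Permutation′ n → ℕ → ℕ
pointsInCyclesOfLength {n} α l =
  length (filterᵇ (λ x → does (Data.Nat._≟_ (cycleLength α x) l)) (allFin n))

-- cycle structure: entry i = number of cycles of length i+1
CycleStructure : ∀ {n} → Permutation′ n → Vec ℕ n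
CycleStructure α = tabulate λ i → pointsInCyclesOfLength α (suc (toℕ i)) / suc (toℕ i)

Isotopism : ℕ → Set
Isotopism n = Permutation′ n × Permutation′ n × Permutation′ n

component : ∀ {n} → Isotopism n → Fin 3 → Permutation′ n
component (α , β , γ) Fin.zero = α
component (α , β , γ) (Fin.suc Fin.zero) = β
component (α , β , γ) (Fin.suc (Fin.suc Fin.zero)) = γ

Array : ℕ → Set
Array n = Vec (Vec (Maybe (Fin n)) n) n

_∈O_ : ∀ {n} → Fin n × Fin n × Fin n → Array n → Set
(r , c , s) ∈O P = lookup (lookup P r) c ≡ just s

IsPartialLatinSquare : ∀ {n} → Array n → Set
IsPartialLatinSquare {n} P =
  (∀ (r c c′ s : Fin n) → (r , c , s) ∈O P → (r , c′ , s) ∈O P → c ≡ c′) ×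
  (∀ (r r′ c s : Fin n) → (r , c , s) ∈O P → (r′ , c , s) ∈O P → r ≡ r′)

NonEmpty : ∀ {n} → Array n → Set
NonEmpty {n} P = Σ (Fin n) λ r → Σ (Fin n) λ c → Σ (Fin n) λ s → (r , c , s) ∈O P

size : ∀ {n} → Array n → ℕ
size {n} P = sum (lmap (λ r → length (filterᵇ (λ c → is-just (lookup (lookup P r) c)) (allFin n))) (allFin n))

IsAutotopism : ∀ {n} → Isotopism n → Array n → Set
IsAutotopism {n} (α , β , γ) P =
  (∀ (r c s : Fin n) → (r , c , s) ∈O P → (α ⟨$⟩ʳ r , β ⟨$⟩ʳ c , γ ⟨$⟩ʳ s) ∈O P) ×
  (∀ (r′ c′ s′ : Fin n) → (r′ , c′ , s′) ∈O P →
     Σ (Fin n) λ r → Σ (Fin n) λ c → Σ (Fin n) λ s →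
       (r , c , s) ∈O P × (α ⟨$⟩ʳ r ≡ r′) × (β ⟨$⟩ʳ c ≡ c′) × (γ ⟨$⟩ʳ s ≡ s′))

Square : ℕ → Set
Square n = Vec (Vec (Fin n) n) n

IsLatinSquare : ∀ {n} → Square n → Set
IsLatinSquare {n} L =
  (∀ (r s : Fin n) → Σ (Fin n) λ c → lookup (lookup L r) c ≡ s ×
      (∀ c′ → lookup (lookup L r) c′ ≡ s → c′ ≡ c)) ×
  (∀ (c s : Fin n) → Σ (Fin n) λ r → lookup (lookup L r) c ≡ s ×
      (∀ r′ → lookup (lookup L r′) c ≡ s → r′ ≡ r))

asArray : ∀ {n} → Square n → Array n
asArray L = map (map just) L

IsCompletable : ∀ {n} → Isotopism n → Array n → Set
IsCompletable {n} Θ P = Σ (Square n) λ L → IsLatinSquare L × IsAutotopism Θ (asArray L) ×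
  (∀ (r c s : Fin n) → (r , c , s) ∈O P → (r , c , s) ∈O asArray L)

InC : ∀ {n} → Isotopism n → Array n → Set
InC Θ P = IsPartialLatinSquare P × NonEmpty P × IsAutotopism Θ P × IsCompletable Θ P

-- C_Θ and C_{Θ,s} as types whose elements are the arrays P themselves
-- (proofs are irrelevant, so two elements are equal iff their arrays are equal)
C : ∀ {n} → Isotopism n → Set
C Θ = Refinement (Array _) (InC Θ)

C[_,_] : ∀ {n} → Isotopism n → ℕ → Set
C[ Θ , s ] = Refinement (Array _) (λ P → InC Θ P × size P ≡ s)

CycleStructurePermuted : ∀ {n} → Isotopism n → Isotopism n → Set
CycleStructurePermuted Θ₁ Θ₂ = Σ (Permutation′ 3) λ σ →
  ∀ i → CycleStructure (component Θ₁ i) ≡ CycleStructure (component Θ₂ (σ ⟨$⟩ʳ i))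

-- Permutations with the same cycle structure are conjugate: pair the cycles of equal length
-- one by one and send x, πx, π²x, … to y, ρy, ρ²y, …; this is possible because the number
-- of points on cycles of each length (a multiple of that length) is determined by the cycle
-- structure. Conjugating the three components of Θ by such permutations, and transposing two
-- of the coordinates (row, column, symbol), are bijections of [n]³ that preserve partial Latin
-- squares, Latin squares and sizes, and turn autotopisms of Θ into autotopisms of the
-- correspondingly transformed isotopism. They therefore induce size-preserving bijections
-- between the sets C_Θ, and every rearrangement of the components is a composite of the
-- transpositions (12) and (23).

module Submission where

open import Defs
open import Data.Nat.Properties hiding (suc-injective)
open import Algebra.Properties.CommutativeMonoid.Sum +-0-commutativeMonoid
  using (sum; sum-cong-≗; ∑-distrib-+; ∑-comm; ∑-permute)
open import Data.Bool as Bool using (Bool; true; false; _∧_; not; if_then_else_)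
open import Data.Bool.Properties using (∧-zeroʳ; ∧-identityʳ; ∧-conicalˡ; ∧-conicalʳ; ¬-not; not-involutive)
open import Data.Fin as Fin using (Fin; toℕ; fromℕ<)
open import Data.Fin.Patterns using (0F; 1F; 2F)
open import Data.Fin.Permutation using (Permutation′; _⟨$⟩ʳ_; _⟨$⟩ˡ_; inverseˡ; inverseʳ; permutation; flip)
open import Data.Fin.Properties using (all?; any?; suc-injective; pigeonhole; toℕ<n; toℕ-injective; toℕ-fromℕ<)
open import Data.Irrelevant using ([_])
import Data.List as List
open import Data.List.Relation.Unary.Any using (here; there)
open import Data.Maybe as Maybe using (Maybe; just; nothing)
import Data.Maybe.Properties as Maybe
open import Data.Nat as ℕ using (ℕ; zero; suc; _+_; _*_; _∸_; _≤_; _<_; z≤n; s≤s)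
open import Data.Nat.Divisibility using (_∣_; _∣0; ∣-reflexive; ∣m∣n⇒∣m+n)
open import Data.Nat.DivMod using (_/_; m/n*n≡m)
open import Data.Nat.ListAction using () renaming (sum to sumˡ)
open import Data.Product using (∃; _×_; _,_; proj₁; proj₂)
import Data.Product.Properties as Product
open import Data.Refinement using (Refinement; _,_)
open import Data.Refinement.Properties using (value-injective)
open import Data.Vec as Vec using (lookup; tabulate)
open import Data.Vec.Properties as Vec using (lookup∘tabulate; tabulate∘lookup; tabulate-cong; lookup-map)
open import Function using (_∘_; _$_; _⇔_; mk⇔; Equivalence; _↔_; mk↔ₛ′)
open import Function.Properties.Inverse using (↔-refl; ↔-trans)
open import Level using (0ℓ)
open import Relation.Binary.Definitions using (tri<; tri≈; tri>)
open import Relation.Binary.PropositionalEquality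
open import Relation.Nullary using (Dec; yes; no; does; ¬?; _→-dec_; contradiction)
open import Relation.Nullary.Decidable using (dec-true; dec-false; dec⇒maybe; recompute; does-⇔; from-yes)
open import Relation.Unary using (Pred; Decidable; _≐_)
open import Relation.Unary.Properties using (≐-sym; ≐-trans)

open import Data.List.Membership.DecPropositional
  (Product.≡-dec (Fin._≟_ {3}) (Product.≡-dec (Fin._≟_ {3}) (Fin._≟_ {3}))) using (_∈_; _∈?_)

dec-true⁻¹ : ∀ {A : Set} (a? : Dec A) → does a? ≡ true → A
dec-true⁻¹ (yes a) _ = a

-- Counting

fromBool : Bool → ℕ
fromBool true  = 1
fromBool false = 0

count : ∀ {n} → (Fin n → Bool) → ℕ
count p = sum (fromBool ∘ p)

count-cong : ∀ {n} {p q : Fin n → Bool} → (∀ x → p x ≡ q x) → count p ≡ count q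
count-cong p≗q = sum-cong-≗ (cong fromBool ∘ p≗q)

count-split : ∀ {n} (p q : Fin n → Bool) →
  count p ≡ count (λ x → p x ∧ q x) + count (λ x → p x ∧ not (q x))
count-split p q = trans (sum-cong-≗ (λ x → split (p x) (q x)))
                        (∑-distrib-+ (fromBool ∘ (λ x → p x ∧ q x)) _)
  where
  split : ∀ a b → fromBool a ≡ fromBool (a ∧ b) + fromBool (a ∧ not b)
  split false b     = refl
  split true  false = refl
  split true  true  = refl

count-false : ∀ {n} (p : Fin n → Bool) → (∀ x → p x ≡ false) → count p ≡ 0
count-false {zero}  p p≡false = refl
count-false {suc n} p p≡false rewrite p≡false Fin.zero = count-false (p ∘ Fin.suc) (p≡false ∘ Fin.suc)

count-true : ∀ {n} (p : Fin n → Bool) (x : Fin n) → p x ≡ true → 1 ≤ count p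
count-true p Fin.zero    px rewrite px = s≤s z≤n
count-true p (Fin.suc x) px = ≤-trans (count-true (p ∘ Fin.suc) x px) (m≤n+m _ (fromBool (p Fin.zero)))

count-witness : ∀ {n} (p : Fin n → Bool) → 1 ≤ count p → ∃ λ x → p x ≡ true
count-witness {suc n} p 1≤count with p Fin.zero in p0
... | true  = Fin.zero , p0
... | false = let x , px = count-witness (p ∘ Fin.suc) 1≤count in Fin.suc x , px

count-≡ : ∀ {n} (y : Fin n) → count (λ x → does (x Fin.≟ y)) ≡ 1
count-≡ {suc n} Fin.zero = cong suc (count-false {n} _ (λ _ → refl))
count-≡ {suc n} (Fin.suc y) = trans (count-cong shift) (count-≡ y)
  where
  shift : ∀ x → does (Fin.suc x Fin.≟ Fin.suc y) ≡ does (x Fin.≟ y)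
  shift x with x Fin.≟ y
  ... | yes _ = refl
  ... | no  _ = refl

count-image : ∀ {k n} (e : Fin k → Fin n) → (∀ {i j} → e i ≡ e j → i ≡ j) →
  count (λ x → does (any? λ i → e i Fin.≟ x)) ≡ k
count-image {zero} {n} e e-inj = count-false {n} _ (λ _ → refl)
count-image {suc k} e e-inj = begin
  count (λ x → does (any? λ i → e i Fin.≟ x))
    ≡⟨ sum-cong-≗ split ⟩
  sum (λ x → fromBool (does (x Fin.≟ e Fin.zero)) + fromBool (does (any? λ i → e (Fin.suc i) Fin.≟ x)))
    ≡⟨ ∑-distrib-+ (λ x → fromBool (does (x Fin.≟ e Fin.zero))) _ ⟩
  count (λ x → does (x Fin.≟ e Fin.zero)) + count (λ x → does (any? λ i → e (Fin.suc i) Fin.≟ x))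
    ≡⟨ cong₂ _+_ (count-≡ (e Fin.zero)) (count-image (e ∘ Fin.suc) (suc-injective ∘ e-inj)) ⟩
  suc k ∎
  where
  open ≡-Reasoning
  split : ∀ x → fromBool (does (any? λ i → e i Fin.≟ x)) ≡
                fromBool (does (x Fin.≟ e Fin.zero)) + fromBool (does (any? λ i → e (Fin.suc i) Fin.≟ x))
  split x with e Fin.zero Fin.≟ x | x Fin.≟ e Fin.zero | any? (λ i → e (Fin.suc i) Fin.≟ x)
  ... | yes e₀≡x | _         | yes (i , eᵢ≡x) = contradiction (e-inj (trans e₀≡x (sym eᵢ≡x))) λ ()
  ... | yes _    | yes _     | no _ = refl
  ... | yes e₀≡x | no x≢e₀   | no _ = contradiction (sym e₀≡x) x≢e₀
  ... | no e₀≢x  | yes x≡e₀  | _    = contradiction (sym x≡e₀) e₀≢x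
  ... | no _     | no _      | yes _ = refl
  ... | no _     | no _      | no _  = refl

length-filter-allFin : ∀ {n} (p : Fin n → Bool) → List.length (List.filterᵇ p (List.allFin n)) ≡ count p
length-filter-allFin p = go p (λ x → x)
  where
  go : ∀ {n} {A : Set} (p : A → Bool) (g : Fin n → A) →
       List.length (List.filterᵇ p (List.tabulate g)) ≡ count (p ∘ g)
  go {zero}  p g = refl
  go {suc n} p g with p (g Fin.zero)
  ... | true  = cong suc (go p (g ∘ Fin.suc))
  ... | false = go p (g ∘ Fin.suc)

-- Cycles of a permutation

iterate : ∀ {A : Set} → (A → A) → ℕ → A → A
iterate f zero    x = x
iterate f (suc k) x = f (iterate f k x)

module _ {A : Set} (f : A → A) where

  iterate-+ : ∀ i j x → iterate f (i + j) x ≡ iterate f i (iterate f j x)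
  iterate-+ zero    j x = refl
  iterate-+ (suc i) j x = cong f (iterate-+ i j x)

  iterate-comm : ∀ k x → iterate f k (f x) ≡ f (iterate f k x)
  iterate-comm zero    x = refl
  iterate-comm (suc k) x = cong f (iterate-comm k x)

suc-mod : ℕ → ℕ → ℕ
suc-mod L i with suc i ℕ.≟ L
... | yes _ = 0
... | no  _ = suc i

module _ {A : Set} (f : A → A) where

  suc-mod-spec : ∀ {L x} i → i < L → iterate f L x ≡ x →
    suc-mod L i < L × iterate f (suc-mod L i) x ≡ f (iterate f i x)
  suc-mod-spec {L} {x} i i<L fᴸx≡x with suc i ℕ.≟ L
  ... | yes 1+i≡L = ≤-trans (s≤s z≤n) i<L , sym (subst (λ k → iterate f k x ≡ x) (sym 1+i≡L) fᴸx≡x)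
  ... | no  1+i≢L = ≤∧≢⇒< i<L 1+i≢L , refl

findPeriod-spec : ∀ {n} (f : Fin n → Fin n) x y k fuel m →
  y ≡ iterate f k x → k ≤ m → m ≤ k + fuel → iterate f m x ≡ x →
  let p = findPeriod f x y k fuel in
  iterate f p x ≡ x × k ≤ p × p ≤ m × (∀ j → k ≤ j → j < p → iterate f j x ≢ x)
findPeriod-spec f x y k fuel m y≡fᵏx k≤m m≤k+fuel fᵐx≡x with y Fin.≟ x
... | yes y≡x = trans (sym y≡fᵏx) y≡x , ≤-refl , k≤m , λ j k≤j j<k → contradiction (≤-<-trans k≤j j<k) (<-irrefl refl)
findPeriod-spec f x y k zero m y≡fᵏx k≤m m≤k+fuel fᵐx≡x | no y≢x =
  contradiction (trans y≡fᵏx (trans (cong (λ i → iterate f i x) k≡m) fᵐx≡x)) y≢x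
  where k≡m = ≤-antisym k≤m (subst (m ≤_) (+-identityʳ k) m≤k+fuel)
findPeriod-spec f x y k (suc fuel) m y≡fᵏx k≤m m≤k+fuel fᵐx≡x | no y≢x
  with findPeriod-spec f x (f y) (suc k) fuel m (cong f y≡fᵏx) k<m (subst (m ≤_) (+-suc k fuel) m≤k+fuel) fᵐx≡x
  where k<m = ≤∧≢⇒< k≤m (λ k≡m → y≢x (trans y≡fᵏx (trans (cong (λ i → iterate f i x) k≡m) fᵐx≡x)))
... | returns , k<p , p≤m , least = returns , ≤-trans (n≤1+n k) k<p , p≤m , least′
  where
  least′ : ∀ j → k ≤ j → j < findPeriod f x (f y) (suc k) fuel → iterate f j x ≢ x
  least′ j k≤j j<p with j ℕ.≟ k
  ... | yes refl = λ fᵏx≡x → y≢x (trans y≡fᵏx fᵏx≡x)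
  ... | no  j≢k  = least j (≤∧≢⇒< k≤j (j≢k ∘ sym)) j<p

record IsLeastPeriod {A : Set} (f : A → A) (x : A) (k : ℕ) : Set where
  field
    positive : 1 ≤ k
    returns  : iterate f k x ≡ x
    least    : ∀ j → 1 ≤ j → j < k → iterate f j x ≢ x

leastPeriod-unique : ∀ {A : Set} {f : A → A} {x k k′} →
  IsLeastPeriod f x k → IsLeastPeriod f x k′ → k ≡ k′
leastPeriod-unique {k = k} {k′} p p′ with <-cmp k k′
... | tri< k<k′ _ _ = contradiction (IsLeastPeriod.returns p) (IsLeastPeriod.least p′ k (IsLeastPeriod.positive p) k<k′)
... | tri≈ _ k≡k′ _ = k≡k′
... | tri> _ _ k′<k = contradiction (IsLeastPeriod.returns p′) (IsLeastPeriod.least p k′ (IsLeastPeriod.positive p′) k′<k)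

_when≡_ : ℕ → ℕ → ℕ
c when≡ l = if does (c ℕ.≟ l) then c else 0

module Cycles {n : ℕ} (π : Permutation′ n) where

  f : Fin n → Fin n
  f = π ⟨$⟩ʳ_

  f^ : ℕ → Fin n → Fin n
  f^ = iterate f

  len : Fin n → ℕ
  len = cycleLength π

  f-injective : ∀ {x y} → f x ≡ f y → x ≡ y
  f-injective {x} {y} fx≡fy = trans (sym (inverseˡ π)) (trans (cong (π ⟨$⟩ˡ_) fx≡fy) (inverseˡ π))

  f^-injective : ∀ k {x y} → f^ k x ≡ f^ k y → x ≡ y
  f^-injective zero    eq = eq
  f^-injective (suc k) eq = f^-injective k (f-injective eq)

  -- Two of the points x, f x, …, fⁿ x coincide, and injectivity moves the coincidence back to x.
  period-exists : ∀ x → ∃ λ m → 1 ≤ m × m ≤ n × f^ m x ≡ x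
  period-exists x with pigeonhole (n<1+n n) (λ (i : Fin (suc n)) → f^ (toℕ i) x)
  ... | i , j , i<j , fⁱx≡fʲx = m , m<n⇒0<n∸m i<j , m≤n , sym x≡fᵐx
    where
    m = toℕ j ∸ toℕ i
    m≤n = ≤-trans (m∸n≤m (toℕ j) (toℕ i)) (ℕ.≤-pred (toℕ<n j))
    x≡fᵐx : x ≡ f^ m x
    x≡fᵐx = f^-injective (toℕ i) (begin
      f^ (toℕ i) x       ≡⟨ fⁱx≡fʲx ⟩
      f^ (toℕ j) x       ≡⟨ cong (λ k → f^ k x) (sym (m+[n∸m]≡n (<⇒≤ i<j))) ⟩
      f^ (toℕ i + m) x   ≡⟨ iterate-+ f (toℕ i) m x ⟩
      f^ (toℕ i) (f^ m x) ∎)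
      where open ≡-Reasoning

  len-spec : ∀ x → IsLeastPeriod f x (len x) × len x ≤ n
  len-spec x with period-exists x
  ... | m , 1≤m , m≤n , fᵐx≡x with findPeriod-spec f x (f x) 1 n m refl 1≤m (m≤n⇒m≤1+n m≤n) fᵐx≡x
  ... | returns , positive , len≤m , least = record { positive = positive ; returns = returns ; least = least } , ≤-trans len≤m m≤n

  module _ (x : Fin n) where
    open IsLeastPeriod (proj₁ (len-spec x)) public
      renaming (positive to len-positive; returns to len-returns; least to len-least)

  len-≤ : ∀ x → len x ≤ n
  len-≤ x = proj₂ (len-spec x)

  len-f : ∀ x → len (f x) ≡ len x
  len-f x = leastPeriod-unique (proj₁ (len-spec (f x))) record
    { positive = len-positive x
    ; returns  = trans (iterate-comm f (len x) x) (cong f (len-returns x))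
    ; least    = λ j 1≤j j<len fʲfx≡fx → len-least x j 1≤j j<len (f-injective (trans (sym (iterate-comm f j x)) fʲfx≡fx))
    }

  len-f^ : ∀ i x → len (f^ i x) ≡ len x
  len-f^ zero    x = refl
  len-f^ (suc i) x = trans (len-f (f^ i x)) (len-f^ i x)

  f^-distinct-below : ∀ a {i j} → i < j → j < len a → f^ i a ≢ f^ j a
  f^-distinct-below a {i} {j} i<j j<len fⁱa≡fʲa =
    len-least a (j ∸ i) (m<n⇒0<n∸m i<j) (≤-<-trans (m∸n≤m j i) j<len) (sym (f^-injective i (begin
      f^ i a              ≡⟨ fⁱa≡fʲa ⟩
      f^ j a              ≡⟨ cong (λ k → f^ k a) (sym (m+[n∸m]≡n (<⇒≤ i<j))) ⟩
      f^ (i + (j ∸ i)) a  ≡⟨ iterate-+ f i (j ∸ i) a ⟩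
      f^ i (f^ (j ∸ i) a) ∎)))
    where open ≡-Reasoning

  f^-injective-below : ∀ a {i j} → i < len a → j < len a → f^ i a ≡ f^ j a → i ≡ j
  f^-injective-below a {i} {j} i<len j<len fⁱa≡fʲa with <-cmp i j
  ... | tri< i<j _ _ = contradiction fⁱa≡fʲa (f^-distinct-below a i<j j<len)
  ... | tri≈ _ i≡j _ = i≡j
  ... | tri> _ _ j<i = contradiction (sym fⁱa≡fʲa) (f^-distinct-below a j<i i<len)

  InOrbit : Fin n → Fin n → Set
  InOrbit a x = ∃ λ (i : Fin (len a)) → f^ (toℕ i) a ≡ x

  inOrbit? : ∀ a x → Dec (InOrbit a x)
  inOrbit? a x = any? λ i → f^ (toℕ i) a Fin.≟ x

  orbit : Fin n → Fin n → Bool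
  orbit a x = does (inOrbit? a x)

  orbit-intro : ∀ a {i x} → i < len a → f^ i a ≡ x → orbit a x ≡ true
  orbit-intro a {i} i<len fⁱa≡x =
    dec-true (inOrbit? a _) (fromℕ< i<len , trans (cong (λ k → f^ k a) (toℕ-fromℕ< i<len)) fⁱa≡x)

  orbit-self : ∀ a → orbit a a ≡ true
  orbit-self a = orbit-intro a (len-positive a) refl

  orbit-f⁻¹ : ∀ a {x} → orbit a (f x) ≡ true → orbit a x ≡ true
  orbit-f⁻¹ a {x} a~fx with dec-true⁻¹ (inOrbit? a (f x)) a~fx
  ... | i , fⁱa≡fx = preimage (toℕ i) (toℕ<n i) fⁱa≡fx
    where
    preimage : ∀ j → j < len a → f^ j a ≡ f x → orbit a x ≡ true
    preimage (suc j) 1+j<len fᶦa≡fx = orbit-intro a (<-trans (n<1+n j) 1+j<len) (f-injective fᶦa≡fx)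
    preimage zero    _       a≡fx   = orbit-intro a (≤-reflexive (suc-pred (len a))) (f-injective (begin
      f (f^ (ℕ.pred (len a)) a) ≡⟨ cong (λ k → f^ k a) (suc-pred (len a)) ⟩
      f^ (len a) a              ≡⟨ len-returns a ⟩
      a                         ≡⟨ a≡fx ⟩
      f x                       ∎))
      where
      open ≡-Reasoning
      instance _ = ℕ.>-nonZero (len-positive a)

  orbit-len : ∀ a {x} → orbit a x ≡ true → len x ≡ len a
  orbit-len a {x} a~x with dec-true⁻¹ (inOrbit? a x) a~x
  ... | i , fⁱa≡x = trans (cong len (sym fⁱa≡x)) (len-f^ (toℕ i) a)

  count-orbit : ∀ a → count (orbit a) ≡ len a
  count-orbit a = count-image (λ i → f^ (toℕ i) a)
    (λ fⁱa≡fʲa → toℕ-injective (f^-injective-below a (toℕ<n _) (toℕ<n _) fⁱa≡fʲa))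

  Closed : (Fin n → Bool) → Set
  Closed A = ∀ x → A x ≡ true → A (f x) ≡ true

  closed-f^ : ∀ {A} → Closed A → ∀ i {x} → A x ≡ true → A (f^ i x) ≡ true
  closed-f^ closed zero    Ax = Ax
  closed-f^ closed (suc i) Ax = closed _ (closed-f^ closed i Ax)

  orbit-⊆ : ∀ {A} → Closed A → ∀ {a x} → A a ≡ true → orbit a x ≡ true → A x ≡ true
  orbit-⊆ {A} closed {a} {x} Aa a~x with dec-true⁻¹ (inOrbit? a x) a~x
  ... | i , fⁱa≡x = subst (λ y → A y ≡ true) fⁱa≡x (closed-f^ closed (toℕ i) Aa)

  removeOrbit : (Fin n → Bool) → Fin n → Fin n → Bool
  removeOrbit A a x = A x ∧ not (orbit a x)

  orbit-f-false : ∀ a {x} → orbit a x ≡ false → orbit a (f x) ≡ false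
  orbit-f-false a a≁x = ¬-not (λ a~fx → contradiction (trans (sym (orbit-f⁻¹ a a~fx)) a≁x) λ ())

  removeOrbit-closed : ∀ {A} → Closed A → ∀ a → Closed (removeOrbit A a)
  removeOrbit-closed {A} closed a x A∖a∋x with A x in Ax | orbit a x in a~x
  ... | true  | false rewrite closed x Ax | orbit-f-false a a~x = refl
  ... | true  | true  = contradiction A∖a∋x λ ()
  ... | false | _     = contradiction A∖a∋x λ ()

  count-removeOrbit< : ∀ {A} → Closed A → ∀ {a} → A a ≡ true → count (removeOrbit A a) < count A
  count-removeOrbit< {A} closed {a} Aa = begin-strict
    count (removeOrbit A a)                                    <⟨ m<n+m _ (count-true _ a Aa∧a~a) ⟩
    count (λ x → A x ∧ orbit a x) + count (removeOrbit A a)    ≡⟨ sym (count-split A (orbit a)) ⟩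
    count A                                                    ∎
    where
    open ≤-Reasoning
    Aa∧a~a : A a ∧ orbit a a ≡ true
    Aa∧a~a rewrite Aa = orbit-self a

  hasLength : ℕ → Fin n → Bool
  hasLength l x = does (len x ℕ.≟ l)

  countOfLength : (Fin n → Bool) → ℕ → ℕ
  countOfLength A l = count (λ x → A x ∧ hasLength l x)

  countOfLength-len : ∀ {A x} → A x ≡ true → 1 ≤ countOfLength A (len x)
  countOfLength-len {A} {x} Ax = count-true (λ y → A y ∧ hasLength (len x) y) x
    (subst (λ b → b ∧ hasLength (len x) x ≡ true) (sym Ax) (dec-true (len x ℕ.≟ len x) refl))

  countOfLength-removeOrbit : ∀ {A} → Closed A → ∀ {a} → A a ≡ true → ∀ l →
    countOfLength A l ≡ countOfLength (removeOrbit A a) l + len a when≡ l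
  countOfLength-removeOrbit {A} closed {a} Aa l = begin
    countOfLength A l
      ≡⟨ count-split (λ x → A x ∧ hasLength l x) (orbit a) ⟩
    count (λ x → (A x ∧ hasLength l x) ∧ orbit a x) + count (λ x → (A x ∧ hasLength l x) ∧ not (orbit a x))
      ≡⟨ cong₂ _+_ (count-cong onOrbit) (count-cong (λ x → reorder (A x) (hasLength l x) (orbit a x))) ⟩
    count (λ x → orbit a x ∧ hasLength l a) + countOfLength (removeOrbit A a) l
      ≡⟨ cong (_+ countOfLength (removeOrbit A a) l) (orbitPart (len a ℕ.≟ l)) ⟩
    len a when≡ l + countOfLength (removeOrbit A a) l
      ≡⟨ +-comm (len a when≡ l) _ ⟩
    countOfLength (removeOrbit A a) l + len a when≡ l ∎
    where
    open ≡-Reasoning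
    onOrbit : ∀ x → (A x ∧ hasLength l x) ∧ orbit a x ≡ orbit a x ∧ hasLength l a
    onOrbit x with orbit a x in a~x
    ... | true  rewrite orbit-⊆ closed Aa a~x | orbit-len a a~x = ∧-identityʳ _
    ... | false = ∧-zeroʳ _
    reorder : ∀ p q r → (p ∧ q) ∧ not r ≡ (p ∧ not r) ∧ q
    reorder false q     r     = refl
    reorder true  false false = refl
    reorder true  false true  = refl
    reorder true  true  r     = sym (∧-identityʳ (not r))
    orbitPart : (d : Dec (len a ≡ l)) → count (λ x → orbit a x ∧ does d) ≡ (if does d then len a else 0)
    orbitPart (yes _) = trans (count-cong (λ x → ∧-identityʳ (orbit a x))) (count-orbit a)
    orbitPart (no  _) = count-false _ (λ x → ∧-zeroʳ (orbit a x))

  orbit-induction : (P : (Fin n → Bool) → Set) →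
    (∀ A → (∀ x → A x ≡ false) → P A) →
    (∀ A a → Closed A → A a ≡ true → P (removeOrbit A a) → P A) →
    ∀ A → Closed A → P A
  orbit-induction P empty step A = go (suc (count A)) A ≤-refl
    where
    go : ∀ N A → count A < N → Closed A → P A
    go (suc N) A count<N closed with any? (λ x → A x Bool.≟ true)
    ... | no  A≡∅   = empty A (λ x → ¬-not (λ Ax → A≡∅ (x , Ax)))
    ... | yes (a , Aa) = step A a closed Aa
      (go N (removeOrbit A a) (<-≤-trans (count-removeOrbit< closed Aa) (ℕ.≤-pred count<N)) (removeOrbit-closed closed a))

  countOfLength-∣ : ∀ A → Closed A → ∀ l → l ∣ countOfLength A l
  countOfLength-∣ = orbit-induction (λ A → ∀ l → l ∣ countOfLength A l)
    (λ A A≡∅ l → subst (l ∣_) (sym (count-false _ (λ x → cong (_∧ hasLength l x) (A≡∅ x)))) (l ∣0))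
    (λ A a closed Aa ih l → subst (l ∣_) (sym (countOfLength-removeOrbit closed Aa l))
      (∣m∣n⇒∣m+n (ih l) (cycle-∣ (len a ℕ.≟ l))))
    where
    cycle-∣ : ∀ {c l} (d : Dec (c ≡ l)) → l ∣ (if does d then c else 0)
    cycle-∣ (yes c≡l) = ∣-reflexive (sym c≡l)
    cycle-∣ (no  _)   = _ ∣0

-- Permutations with the same cycle structure are conjugate

module OrbitExtension {n : ℕ} (π ρ : Permutation′ n) where
  module P = Cycles π
  module R = Cycles ρ

  extend : Fin n → Fin n → (Fin n → Fin n) → Fin n → Fin n
  extend a b h x with P.inOrbit? a x
  ... | yes (i , _) = R.f^ (toℕ i) b
  ... | no  _       = h x

  extend-orbit : ∀ a b h {i x} → i < P.len a → P.f^ i a ≡ x → extend a b h x ≡ R.f^ i b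
  extend-orbit a b h {i} {x} i<len fⁱa≡x with P.inOrbit? a x
  ... | yes (j , fʲa≡x) = cong (λ k → R.f^ k b) (P.f^-injective-below a (toℕ<n j) i<len (trans fʲa≡x (sym fⁱa≡x)))
  ... | no  a≁x         = contradiction (dec-true⁻¹ (P.inOrbit? a x) (P.orbit-intro a i<len fⁱa≡x)) a≁x

  extend-off : ∀ a b h {x} → P.orbit a x ≡ false → extend a b h x ≡ h x
  extend-off a b h {x} a≁x with P.inOrbit? a x
  ... | no _ = refl

  data Position (A : Fin n → Bool) (a x : Fin n) : Set where
    onOrbit : ∀ i → i < P.len a → P.f^ i a ≡ x → Position A a x
    offOrbit : P.orbit a x ≡ false → P.removeOrbit A a x ≡ true → Position A a x

  position : ∀ {A} a {x} → A x ≡ true → Position A a x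
  position {A} a {x} Ax with P.inOrbit? a x
  ... | yes (i , fⁱa≡x) = onOrbit (toℕ i) (toℕ<n i) fⁱa≡x
  ... | no  a≁x = offOrbit a≁x′ (subst₂ (λ p q → p ∧ not q ≡ true) (sym Ax) (sym a≁x′) refl)
    where a≁x′ = dec-false (P.inOrbit? a x) a≁x

  module _ {A B : Fin n → Bool} (closedB : R.Closed B) {a b : Fin n} (Bb : B b ≡ true)
           (len-b≡len-a : R.len b ≡ P.len a) {h : Fin n → Fin n}
           (h-∈ : ∀ {x} → P.removeOrbit A a x ≡ true → R.removeOrbit B b (h x) ≡ true) where

    extend-∈ : ∀ {x} → A x ≡ true → B (extend a b h x) ≡ true
    extend-∈ {x} Ax with position {A} a Ax
    ... | onOrbit i i<len fⁱa≡x = subst (λ y → B y ≡ true) (sym (extend-orbit a b h i<len fⁱa≡x)) (R.closed-f^ closedB i Bb)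
    ... | offOrbit a≁x rest     = subst (λ y → B y ≡ true) (sym (extend-off a b h a≁x)) (∧-conicalˡ _ _ (h-∈ rest))

    extend-comm : (∀ {x} → P.removeOrbit A a x ≡ true → h (P.f x) ≡ R.f (h x)) →
                  ∀ {x} → A x ≡ true → extend a b h (P.f x) ≡ R.f (extend a b h x)
    extend-comm h-comm {x} Ax with position {A} a Ax
    ... | onOrbit i i<len fⁱa≡x = begin
      extend a b h (P.f x)          ≡⟨ extend-orbit a b h next<len (trans πⁿᵉˣᵗa (cong P.f fⁱa≡x)) ⟩
      R.f^ (suc-mod (P.len a) i) b  ≡⟨ ρⁿᵉˣᵗb ⟩
      R.f (R.f^ i b)                ≡⟨ cong R.f (sym (extend-orbit a b h i<len fⁱa≡x)) ⟩
      R.f (extend a b h x)          ∎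
      where
      open ≡-Reasoning
      πnext = suc-mod-spec P.f i i<len (P.len-returns a)
      next<len = proj₁ πnext
      πⁿᵉˣᵗa = proj₂ πnext
      ρⁿᵉˣᵗb = proj₂ (suc-mod-spec R.f i i<len (subst (λ L → R.f^ L b ≡ b) len-b≡len-a (R.len-returns b)))
    ... | offOrbit a≁x rest = begin
      extend a b h (P.f x)  ≡⟨ extend-off a b h (P.orbit-f-false a a≁x) ⟩
      h (P.f x)             ≡⟨ h-comm rest ⟩
      R.f (h x)             ≡⟨ cong R.f (sym (extend-off a b h a≁x)) ⟩
      R.f (extend a b h x)  ∎
      where open ≡-Reasoning

module _ {n : ℕ} (π ρ : Permutation′ n) where
  private
    module P = Cycles π
    module R = Cycles ρ
    module Fwd = OrbitExtension π ρ
    module Bwd = OrbitExtension ρ π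

  extend-inverse : ∀ {A B : Fin n → Bool} {a b} → R.len b ≡ P.len a → ∀ {h k} →
    (∀ {x} → P.removeOrbit A a x ≡ true → R.removeOrbit B b (h x) ≡ true) →
    (∀ {x} → P.removeOrbit A a x ≡ true → k (h x) ≡ x) →
    ∀ {x} → A x ≡ true → Bwd.extend b a k (Fwd.extend a b h x) ≡ x
  extend-inverse {A} {B} {a} {b} len-b≡len-a {h} {k} h-∈ k∘h {x} Ax with Fwd.position {A} a Ax
  ... | Fwd.onOrbit i i<len fⁱa≡x = begin
    Bwd.extend b a k (Fwd.extend a b h x) ≡⟨ cong (Bwd.extend b a k) (Fwd.extend-orbit a b h i<len fⁱa≡x) ⟩
    Bwd.extend b a k (R.f^ i b)           ≡⟨ Bwd.extend-orbit b a k (subst (i <_) (sym len-b≡len-a) i<len) refl ⟩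
    P.f^ i a                              ≡⟨ fⁱa≡x ⟩
    x                                     ∎
    where open ≡-Reasoning
  ... | Fwd.offOrbit a≁x rest = begin
    Bwd.extend b a k (Fwd.extend a b h x) ≡⟨ cong (Bwd.extend b a k) (Fwd.extend-off a b h a≁x) ⟩
    Bwd.extend b a k (h x)                ≡⟨ Bwd.extend-off b a k b≁hx ⟩
    k (h x)                               ≡⟨ k∘h rest ⟩
    x                                     ∎
    where
    open ≡-Reasoning
    b≁hx = trans (sym (not-involutive _)) (cong not (∧-conicalʳ _ _ (h-∈ rest)))

module Conjugators {n : ℕ} (π ρ : Permutation′ n) where
  module P = Cycles π
  module R = Cycles ρ
  module Fwd = OrbitExtension π ρ
  module Bwd = OrbitExtension ρ π

  record Conjugator (A B : Fin n → Bool) : Set where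
    field
      to from  : Fin n → Fin n
      to-∈     : ∀ {x} → A x ≡ true → B (to x) ≡ true
      from-∈   : ∀ {y} → B y ≡ true → A (from y) ≡ true
      from∘to  : ∀ {x} → A x ≡ true → from (to x) ≡ x
      to∘from  : ∀ {y} → B y ≡ true → to (from y) ≡ y
      to-comm  : ∀ {x} → A x ≡ true → to (P.f x) ≡ R.f (to x)

  SameCycleCounts : (Fin n → Bool) → (Fin n → Bool) → Set
  SameCycleCounts A B = ∀ l → P.countOfLength A l ≡ R.countOfLength B l

  conjugator-∅ : ∀ A → (∀ x → A x ≡ false) → ∀ B → SameCycleCounts A B → Conjugator A B
  conjugator-∅ A A≡∅ B same = record
    { to = λ x → x ; from = λ y → y
    ; to-∈ = ∉A ; from-∈ = ∉B ; from∘to = ∉A ; to∘from = ∉B ; to-comm = ∉A }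
    where
    ∉A : ∀ {X : Set} {x} → A x ≡ true → X
    ∉A {x = x} Ax = contradiction (trans (sym Ax) (A≡∅ x)) λ ()
    ∉B : ∀ {X : Set} {y} → B y ≡ true → X
    ∉B {y = y} By = contradiction (begin
      1                             ≤⟨ R.countOfLength-len {B} By ⟩
      R.countOfLength B (R.len y)   ≡⟨ sym (same (R.len y)) ⟩
      P.countOfLength A (R.len y)   ≡⟨ count-false _ (λ x → cong (_∧ _) (A≡∅ x)) ⟩
      0                             ∎) λ ()
      where open ≤-Reasoning

  conjugator-step : ∀ A a → P.Closed A → A a ≡ true →
    (∀ B → R.Closed B → SameCycleCounts (P.removeOrbit A a) B → Conjugator (P.removeOrbit A a) B) →
    ∀ B → R.Closed B → SameCycleCounts A B → Conjugator A B
  conjugator-step A a closedA Aa ih B closedB same = record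
    { to       = Fwd.extend a b to
    ; from     = Bwd.extend b a from
    ; to-∈     = Fwd.extend-∈ {A} closedB Bb len-b≡len-a to-∈′
    ; from-∈   = Bwd.extend-∈ {B} closedA Aa (sym len-b≡len-a) from-∈′
    ; from∘to  = extend-inverse π ρ {A} {B} len-b≡len-a to-∈′ from∘to
    ; to∘from  = extend-inverse ρ π {B} {A} (sym len-b≡len-a) from-∈′ to∘from
    ; to-comm  = Fwd.extend-comm {A} closedB Bb len-b≡len-a to-∈′ to-comm
    }
    where
    a-counted : 1 ≤ R.countOfLength B (P.len a)
    a-counted = ≤-trans (P.countOfLength-len {A} Aa) (≤-reflexive (same (P.len a)))
    b-found = count-witness (λ y → B y ∧ R.hasLength (P.len a) y) a-counted
    b = proj₁ b-found
    Bb : B b ≡ true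
    Bb = ∧-conicalˡ _ _ (proj₂ b-found)
    len-b≡len-a : R.len b ≡ P.len a
    len-b≡len-a = dec-true⁻¹ (R.len b ℕ.≟ P.len a) (∧-conicalʳ _ _ (proj₂ b-found))
    same′ : SameCycleCounts (P.removeOrbit A a) (R.removeOrbit B b)
    same′ l = +-cancelʳ-≡ (P.len a when≡ l) _ _ (begin
      P.countOfLength (P.removeOrbit A a) l + P.len a when≡ l ≡⟨ sym (P.countOfLength-removeOrbit closedA Aa l) ⟩
      P.countOfLength A l                                     ≡⟨ same l ⟩
      R.countOfLength B l                                     ≡⟨ R.countOfLength-removeOrbit closedB Bb l ⟩
      R.countOfLength (R.removeOrbit B b) l + R.len b when≡ l
        ≡⟨ cong (λ c → R.countOfLength (R.removeOrbit B b) l + c when≡ l) len-b≡len-a ⟩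
      R.countOfLength (R.removeOrbit B b) l + P.len a when≡ l ∎)
      where open ≡-Reasoning
    open Conjugator (ih (R.removeOrbit B b) (R.removeOrbit-closed closedB b) same′) renaming
      (to-∈ to to-∈′; from-∈ to from-∈′)

  conjugator : ∀ A → P.Closed A → ∀ B → R.Closed B → SameCycleCounts A B → Conjugator A B
  conjugator = P.orbit-induction (λ A → ∀ B → R.Closed B → SameCycleCounts A B → Conjugator A B)
    (λ A A≡∅ B _ → conjugator-∅ A A≡∅ B) conjugator-step

module _ {n : ℕ} (π : Permutation′ n) where
  open Cycles π

  pointsInCyclesOfLength≡count : ∀ l → pointsInCyclesOfLength π l ≡ countOfLength (λ _ → true) l
  pointsInCyclesOfLength≡count l = length-filter-allFin (hasLength l)

  pointsInCyclesOfLength-absent : ∀ l → (∀ x → len x ≢ l) → pointsInCyclesOfLength π l ≡ 0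
  pointsInCyclesOfLength-absent l absent =
    trans (pointsInCyclesOfLength≡count l) (count-false _ (λ x → dec-false (len x ℕ.≟ l) (absent x)))

  -- The division in CycleStructure is exact.
  pointsInCyclesOfLength-CycleStructure : ∀ {m} (m<n : m < n) →
    pointsInCyclesOfLength π (suc m) ≡ lookup (CycleStructure π) (fromℕ< m<n) * suc m
  pointsInCyclesOfLength-CycleStructure {m} m<n = begin
    pointsInCyclesOfLength π (suc m)                         ≡⟨ m/n*n≡m suc-m∣points ⟨
    pointsInCyclesOfLength π (suc m) / suc m * suc m         ≡⟨ cong (_* suc m) entry ⟨
    lookup (CycleStructure π) (fromℕ< m<n) * suc m           ∎
    where
    open ≡-Reasoning
    suc-m∣points : suc m ∣ pointsInCyclesOfLength π (suc m)
    suc-m∣points = subst (suc m ∣_) (sym (pointsInCyclesOfLength≡count (suc m)))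
      (countOfLength-∣ (λ _ → true) (λ _ _ → refl) (suc m))
    entry : lookup (CycleStructure π) (fromℕ< m<n) ≡ pointsInCyclesOfLength π (suc m) / suc m
    entry = trans (lookup∘tabulate _ (fromℕ< m<n))
      (cong (λ k → pointsInCyclesOfLength π (suc k) / suc k) (toℕ-fromℕ< m<n))

module _ {n : ℕ} {π ρ : Permutation′ n} where
  private
    module P = Cycles π
    module R = Cycles ρ

  CycleStructure-pointsInCyclesOfLength : CycleStructure π ≡ CycleStructure ρ →
    ∀ l → pointsInCyclesOfLength π l ≡ pointsInCyclesOfLength ρ l
  CycleStructure-pointsInCyclesOfLength same zero = trans
    (pointsInCyclesOfLength-absent π 0 (λ x → m<n⇒n≢0 (P.len-positive x)))
    (sym (pointsInCyclesOfLength-absent ρ 0 (λ x → m<n⇒n≢0 (R.len-positive x))))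
  CycleStructure-pointsInCyclesOfLength same (suc m) with m ℕ.<? n
  ... | yes m<n = trans (pointsInCyclesOfLength-CycleStructure π m<n)
    (trans (cong (λ cs → lookup cs (fromℕ< m<n) * suc m) same) (sym (pointsInCyclesOfLength-CycleStructure ρ m<n)))
  ... | no  m≮n = trans
    (pointsInCyclesOfLength-absent π (suc m) (λ x len≡ → m≮n (subst (_≤ n) len≡ (P.len-≤ x))))
    (sym (pointsInCyclesOfLength-absent ρ (suc m) (λ x len≡ → m≮n (subst (_≤ n) len≡ (R.len-≤ x)))))

conjugate : ∀ {n} (π ρ : Permutation′ n) → CycleStructure π ≡ CycleStructure ρ →
  ∃ λ (σ : Permutation′ n) → ∀ x → σ ⟨$⟩ʳ (π ⟨$⟩ʳ x) ≡ ρ ⟨$⟩ʳ (σ ⟨$⟩ʳ x)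
conjugate π ρ same = permutation to from (λ _ → to∘from refl) (λ _ → from∘to refl) , λ _ → to-comm refl
  where
  open Conjugators π ρ
  same-counts : SameCycleCounts (λ _ → true) (λ _ → true)
  same-counts l = begin
    P.countOfLength (λ _ → true) l  ≡⟨ pointsInCyclesOfLength≡count π l ⟨
    pointsInCyclesOfLength π l      ≡⟨ CycleStructure-pointsInCyclesOfLength {π = π} {ρ} same l ⟩
    pointsInCyclesOfLength ρ l      ≡⟨ pointsInCyclesOfLength≡count ρ l ⟩
    R.countOfLength (λ _ → true) l  ∎
    where open ≡-Reasoning
  open Conjugator (conjugator (λ _ → true) (λ _ _ → refl) (λ _ → true) (λ _ _ → refl) same-counts)

-- Partial Latin squares as ternary relations

Triple : ℕ → Set
Triple n = Fin n × Fin n × Fin n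

TripleRel : ℕ → Set₁
TripleRel n = Pred (Triple n) 0ℓ

O : ∀ {n} → Array n → TripleRel n
O P t = t ∈O P

O? : ∀ {n} (P : Array n) → Decidable (O P)
O? P (r , c , s) = Maybe.≡-dec Fin._≟_ (lookup (lookup P r) c) (just s)

record IsPartialLatin {n} (R : TripleRel n) : Set where
  field
    symbol-unique : ∀ {r c s s′} → R (r , c , s) → R (r , c , s′) → s ≡ s′
    column-unique : ∀ {r c c′ s} → R (r , c , s) → R (r , c′ , s) → c ≡ c′
    row-unique    : ∀ {r r′ c s} → R (r , c , s) → R (r′ , c , s) → r ≡ r′

record IsLatin {n} (R : TripleRel n) : Set where
  field
    isPartialLatin : IsPartialLatin R
    symbol-exists  : ∀ r c → ∃ λ s → R (r , c , s)
    column-exists  : ∀ r s → ∃ λ c → R (r , c , s)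
    row-exists     : ∀ c s → ∃ λ r → R (r , c , s)
  open IsPartialLatin isPartialLatin public

module _ {n} {R S : TripleRel n} (R≐S : R ≐ S) where
  private
    S⊆R = proj₂ R≐S
    R⊆S = proj₁ R≐S

  IsPartialLatin-resp-≐ : IsPartialLatin R → IsPartialLatin S
  IsPartialLatin-resp-≐ pl = record
    { symbol-unique = λ x y → symbol-unique (S⊆R x) (S⊆R y)
    ; column-unique = λ x y → column-unique (S⊆R x) (S⊆R y)
    ; row-unique    = λ x y → row-unique (S⊆R x) (S⊆R y)
    }
    where open IsPartialLatin pl

  IsLatin-resp-≐ : IsLatin R → IsLatin S
  IsLatin-resp-≐ lat = record
    { isPartialLatin = IsPartialLatin-resp-≐ isPartialLatin
    ; symbol-exists  = λ r c → let s , x = symbol-exists r c in s , R⊆S x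
    ; column-exists  = λ r s → let c , x = column-exists r s in c , R⊆S x
    ; row-exists     = λ c s → let r , x = row-exists c s in r , R⊆S x
    }
    where open IsLatin lat

IsPartialLatinSquare⇒IsPartialLatin : ∀ {n} {P : Array n} → IsPartialLatinSquare P → IsPartialLatin (O P)
IsPartialLatinSquare⇒IsPartialLatin (column-unique , row-unique) = record
  { symbol-unique = λ x y → Maybe.just-injective (trans (sym x) y)
  ; column-unique = column-unique _ _ _ _
  ; row-unique    = row-unique _ _ _ _
  }

IsPartialLatin⇒IsPartialLatinSquare : ∀ {n} {P : Array n} → IsPartialLatin (O P) → IsPartialLatinSquare P
IsPartialLatin⇒IsPartialLatinSquare pl = (λ _ _ _ _ → column-unique) , (λ _ _ _ _ → row-unique)
  where open IsPartialLatin pl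

O-asArray : ∀ {n} (L : Square n) {r c s} → O (asArray L) (r , c , s) ⇔ (lookup (lookup L r) c ≡ s)
O-asArray L {r} {c} = mk⇔ (λ x → Maybe.just-injective (trans (sym cell) x)) (λ Lrc≡s → trans cell (cong just Lrc≡s))
  where
  cell : lookup (lookup (asArray L) r) c ≡ just (lookup (lookup L r) c)
  cell = trans (cong (λ row → lookup row c) (lookup-map r (Vec.map just) L)) (lookup-map c just (lookup L r))

IsLatinSquare⇒IsLatin : ∀ {n} {L : Square n} → IsLatinSquare L → IsLatin (O (asArray L))
IsLatinSquare⇒IsLatin {L = L} (row , column) = record
  { isPartialLatin = record
    { symbol-unique = λ x y → Maybe.just-injective (trans (sym x) y)
    ; column-unique = λ {r} {c} {c′} {s} x y →
        trans (proj₂ (proj₂ (row r s)) c (to x)) (sym (proj₂ (proj₂ (row r s)) c′ (to y)))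
    ; row-unique    = λ {r} {r′} {c} {s} x y →
        trans (proj₂ (proj₂ (column c s)) r (to x)) (sym (proj₂ (proj₂ (column c s)) r′ (to y)))
    }
  ; symbol-exists = λ r c → lookup (lookup L r) c , from refl
  ; column-exists = λ r s → proj₁ (row r s) , from (proj₁ (proj₂ (row r s)))
  ; row-exists    = λ c s → proj₁ (column c s) , from (proj₁ (proj₂ (column c s)))
  }
  where open module O-L {r c s} = Equivalence (O-asArray L {r} {c} {s})

IsLatin⇒IsLatinSquare : ∀ {n} {L : Square n} → IsLatin (O (asArray L)) → IsLatinSquare L
IsLatin⇒IsLatinSquare {L = L} lat =
  (λ r s → let c , x = column-exists r s in c , to x , λ c′ y → column-unique (from y) x) ,
  (λ c s → let r , x = row-exists c s in r , to x , λ r′ y → row-unique (from y) x)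
  where
  open IsLatin lat
  open module O-L {r c s} = Equivalence (O-asArray L {r} {c} {s})

arrayOf : ∀ {n} (R : TripleRel n) → Decidable R → Array n
arrayOf R R? = tabulate λ r → tabulate λ c → Maybe.map proj₁ (dec⇒maybe (any? λ s → R? (r , c , s)))

O-arrayOf : ∀ {n} {R : TripleRel n} (R? : Decidable R) →
  (∀ {r c s s′} → R (r , c , s) → R (r , c , s′) → s ≡ s′) → O (arrayOf R R?) ≐ R
O-arrayOf {R = R} R? functional = (λ {t} → proj₁ (both t)) , (λ {t} → proj₂ (both t))
  where
  entry : ∀ r c → lookup (lookup (arrayOf R R?) r) c ≡ Maybe.map proj₁ (dec⇒maybe (any? λ s → R? (r , c , s)))
  entry r c = trans (cong (λ row → lookup row c) (lookup∘tabulate _ r)) (lookup∘tabulate _ c)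
  both : ∀ t → (O (arrayOf R R?) t → R t) × (R t → O (arrayOf R R?) t)
  both (r , c , s) rewrite entry r c with any? (λ s → R? (r , c , s))
  ... | yes (s₀ , x) = (λ s₀≡s → subst (λ s → R (r , c , s)) (Maybe.just-injective s₀≡s) x) , cong just ∘ functional x
  ... | no  ∄        = (λ ()) , λ x → contradiction (s , x) ∄

O-injective : ∀ {n} {P Q : Array n} → O P ≐ O Q → P ≡ Q
O-injective {P = P} {Q} (P⊆Q , Q⊆P) = trans (sym (tabulate∘lookup P))
  (trans (tabulate-cong λ r → trans (sym (tabulate∘lookup (lookup P r)))
     (trans (tabulate-cong (cellsEqual r)) (tabulate∘lookup (lookup Q r))))
   (tabulate∘lookup Q))
  where
  cellsEqual : ∀ r c → lookup (lookup P r) c ≡ lookup (lookup Q r) c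
  cellsEqual r c with lookup (lookup P r) c in p | lookup (lookup Q r) c in q
  ... | just s  | _       = sym (trans (sym q) (P⊆Q {r , c , s} p))
  ... | nothing | nothing = refl
  ... | nothing | just s  = trans (sym p) (Q⊆P {r , c , s} q)

squareOf : ∀ {n} (R : TripleRel n) → (∀ r c → ∃ λ s → R (r , c , s)) → Square n
squareOf R total = tabulate λ r → tabulate λ c → proj₁ (total r c)

O-squareOf : ∀ {n} {R : TripleRel n} (total : ∀ r c → ∃ λ s → R (r , c , s)) →
  (∀ {r c s s′} → R (r , c , s) → R (r , c , s′) → s ≡ s′) → O (asArray (squareOf R total)) ≐ R
O-squareOf {R = R} total functional =
  (λ {(r , c , s)} x → subst (λ s → R (r , c , s))
     (trans (sym (entry r c)) (Equivalence.to (O-asArray (squareOf R total)) x)) (proj₂ (total r c))) ,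
  (λ {(r , c , s)} x → Equivalence.from (O-asArray (squareOf R total)) (trans (entry r c) (functional (proj₂ (total r c)) x)))
  where
  entry : ∀ r c → lookup (lookup (squareOf R total) r) c ≡ proj₁ (total r c)
  entry r c = trans (cong (λ row → lookup row c) (lookup∘tabulate _ r)) (lookup∘tabulate _ c)

sum³ : ∀ {n} → (Triple n → ℕ) → ℕ
sum³ g = sum λ r → sum λ c → sum λ s → g (r , c , s)

sum³-cong : ∀ {n} {g h : Triple n → ℕ} → (∀ t → g t ≡ h t) → sum³ g ≡ sum³ h
sum³-cong g≗h = sum-cong-≗ λ r → sum-cong-≗ λ c → sum-cong-≗ λ s → g≗h (r , c , s)

sumˡ-map-allFin : ∀ {n} (g : Fin n → ℕ) → sumˡ (List.map g (List.allFin n)) ≡ sum g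
sumˡ-map-allFin g = go g (λ x → x)
  where
  go : ∀ {n} {A : Set} (g : A → ℕ) (h : Fin n → A) → sumˡ (List.map g (List.tabulate h)) ≡ sum (g ∘ h)
  go {zero}  g h = refl
  go {suc n} g h = cong (g (h Fin.zero) +_) (go g (h ∘ Fin.suc))

fromBool-is-just : ∀ {n} (m : Maybe (Fin n)) →
  fromBool (Maybe.is-just m) ≡ count (λ s → does (Maybe.≡-dec Fin._≟_ m (just s)))
fromBool-is-just {n} nothing = sym (count-false {n} _ (λ _ → refl))
fromBool-is-just (just x) = sym (trans (count-cong just≟just) (count-≡ x))
  where
  just≟just : ∀ s → does (Maybe.≡-dec Fin._≟_ (just x) (just s)) ≡ does (s Fin.≟ x)
  just≟just s with x Fin.≟ s | s Fin.≟ x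
  ... | yes _   | yes _   = refl
  ... | no  _   | no  _   = refl
  ... | yes x≡s | no  s≢x = contradiction (sym x≡s) s≢x
  ... | no  x≢s | yes s≡x = contradiction (sym s≡x) x≢s

size≡sum³ : ∀ {n} (P : Array n) → size P ≡ sum³ (fromBool ∘ does ∘ O? P)
size≡sum³ {n} P = trans (sumˡ-map-allFin filledInRow) (sum-cong-≗ λ r →
  trans (length-filter-allFin (filled r)) (sum-cong-≗ λ c → fromBool-is-just (lookup (lookup P r) c)))
  where
  filled : Fin n → Fin n → Bool
  filled r c = Maybe.is-just (lookup (lookup P r) c)
  filledInRow : Fin n → ℕ
  filledInRow r = List.length (List.filterᵇ (filled r) (List.allFin n))

act : ∀ {n} → Isotopism n → Triple n → Triple n
act (α , β , γ) (r , c , s) = α ⟨$⟩ʳ r , β ⟨$⟩ʳ c , γ ⟨$⟩ʳ s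

IsAutotopismOf : ∀ {n} → Isotopism n → TripleRel n → Set
IsAutotopismOf Θ R = (∀ {t} → R t → R (act Θ t)) × (∀ {t′} → R t′ → ∃ λ t → R t × act Θ t ≡ t′)

IsAutotopism⇒IsAutotopismOf : ∀ {n} {Θ : Isotopism n} {P : Array n} → IsAutotopism Θ P → IsAutotopismOf Θ (O P)
IsAutotopism⇒IsAutotopismOf {Θ = α , β , γ} (forth , back) =
  (λ {(r , c , s)} → forth r c s) ,
  (λ {(r′ , c′ , s′)} x → let r , c , s , y , αr≡r′ , βc≡c′ , γs≡s′ = back r′ c′ s′ x in
     (r , c , s) , y , cong₂ _,_ αr≡r′ (cong₂ _,_ βc≡c′ γs≡s′))

IsAutotopismOf⇒IsAutotopism : ∀ {n} {Θ : Isotopism n} {P : Array n} → IsAutotopismOf Θ (O P) → IsAutotopism Θ P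
IsAutotopismOf⇒IsAutotopism {Θ = α , β , γ} (forth , back) =
  (λ r c s → forth) ,
  (λ r′ c′ s′ x → let (r , c , s) , y , eq = back x in
     r , c , s , y , cong proj₁ eq , cong (proj₁ ∘ proj₂) eq , cong (proj₂ ∘ proj₂) eq)

IsAutotopismOf-resp-≐ : ∀ {n} {Θ : Isotopism n} {R S : TripleRel n} → R ≐ S → IsAutotopismOf Θ R → IsAutotopismOf Θ S
IsAutotopismOf-resp-≐ (R⊆S , S⊆R) (forth , back) =
  (λ x → R⊆S (forth (S⊆R x))) , (λ x → let t , y , eq = back (S⊆R x) in t , R⊆S y , eq)

-- Transport along symmetries of the triple space

record PreservesLatin {n} (φ : Triple n → Triple n) : Set₁ where
  field
    partialLatin : ∀ {R} → IsPartialLatin R → IsPartialLatin (R ∘ φ)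
    latin        : ∀ {R} → IsLatin R → IsLatin (R ∘ φ)
    sum³-∘       : ∀ g → sum³ (g ∘ φ) ≡ sum³ g

record LatinSymmetry (n : ℕ) : Set₁ where
  field
    to from        : Triple n → Triple n
    to∘from        : ∀ t → to (from t) ≡ t
    from∘to        : ∀ t → from (to t) ≡ t
    to-preserves   : PreservesLatin to
    from-preserves : PreservesLatin from

  inverse : LatinSymmetry n
  inverse = record
    { to = from ; from = to ; to∘from = from∘to ; from∘to = to∘from
    ; to-preserves = from-preserves ; from-preserves = to-preserves }

module _ {n : ℕ} (S : LatinSymmetry n) where
  open LatinSymmetry S
  open PreservesLatin from-preserves

  transport : Array n → Array n
  transport P = arrayOf (O P ∘ from) (O? P ∘ from)

  O-transport : ∀ {P} → IsPartialLatin (O P) → O (transport P) ≐ O P ∘ from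
  O-transport {P} pl = O-arrayOf (O? P ∘ from) (IsPartialLatin.symbol-unique (partialLatin {O P} pl))

  transport-partialLatin : ∀ {P} → IsPartialLatin (O P) → IsPartialLatin (O (transport P))
  transport-partialLatin {P} pl = IsPartialLatin-resp-≐ (≐-sym (O-transport {P} pl)) (partialLatin {O P} pl)

  size-transport : ∀ {P} → IsPartialLatin (O P) → size (transport P) ≡ size P
  size-transport {P} pl = begin
    size (transport P)                               ≡⟨ size≡sum³ (transport P) ⟩
    sum³ (fromBool ∘ does ∘ O? (transport P))
      ≡⟨ sum³-cong (λ t → cong fromBool (does-⇔ (mk⇔ (proj₁ O≐) (proj₂ O≐)) (O? (transport P) t) (O? P (from t)))) ⟩
    sum³ (fromBool ∘ does ∘ O? P ∘ from)             ≡⟨ sum³-∘ (fromBool ∘ does ∘ O? P) ⟩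
    sum³ (fromBool ∘ does ∘ O? P)                    ≡⟨ size≡sum³ P ⟨
    size P                                           ∎
    where
    open ≡-Reasoning
    O≐ = O-transport {P} pl

  transport-completion : ∀ {L : Square n} → IsLatinSquare L →
    ∃ λ L′ → IsLatinSquare L′ × O (asArray L′) ≐ O (asArray L) ∘ from
  transport-completion {L} isLatin = L′ , IsLatin⇒IsLatinSquare {L = L′} (IsLatin-resp-≐ (≐-sym O≐) lat) , O≐
    where
    R : TripleRel n
    R = O (asArray L) ∘ from
    lat : IsLatin R
    lat = latin {O (asArray L)} (IsLatinSquare⇒IsLatin {L = L} isLatin)
    L′ = squareOf R (IsLatin.symbol-exists lat)
    O≐ : O (asArray L′) ≐ R
    O≐ = O-squareOf {R = R} (IsLatin.symbol-exists lat) (IsLatin.symbol-unique lat)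

transport-inverse : ∀ {n} (S : LatinSymmetry n) {P : Array n} → IsPartialLatin (O P) →
  transport (LatinSymmetry.inverse S) (transport S P) ≡ P
transport-inverse S {P} pl =
  O-injective (≐-trans O≐ ((λ {t} → subst (O P) (from∘to t)) , (λ {t} → subst (O P) (sym (from∘to t)))))
  where
  open LatinSymmetry S
  O≐ : O (transport inverse (transport S P)) ≐ O P ∘ from ∘ to
  O≐ = ≐-trans (O-transport inverse {transport S P} (transport-partialLatin S {P} pl))
               ((λ {t} → proj₁ (O-transport S {P} pl) {to t}) , (λ {t} → proj₂ (O-transport S {P} pl) {to t}))

module _ {n : ℕ} (S : LatinSymmetry n) {Θ Θ′ : Isotopism n}
         (intertwines : ∀ t → act Θ′ (LatinSymmetry.to S t) ≡ LatinSymmetry.to S (act Θ t)) where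
  open LatinSymmetry S

  from-intertwines : ∀ t → act Θ (from t) ≡ from (act Θ′ t)
  from-intertwines t = begin
    act Θ (from t)                ≡⟨ from∘to _ ⟨
    from (to (act Θ (from t)))    ≡⟨ cong from (intertwines (from t)) ⟨
    from (act Θ′ (to (from t)))   ≡⟨ cong (from ∘ act Θ′) (to∘from t) ⟩
    from (act Θ′ t)               ∎
    where open ≡-Reasoning

  IsAutotopismOf-∘from : ∀ {R} → IsAutotopismOf Θ R → IsAutotopismOf Θ′ (R ∘ from)
  IsAutotopismOf-∘from {R} (forth , back) =
    (λ {t} x → subst R (from-intertwines t) (forth x)) ,
    (λ {t′} x → let t , y , act≡ = back x in
       to t , subst R (sym (from∘to t)) y , trans (intertwines t) (trans (cong to act≡) (to∘from t′)))

  IsAutotopism-∘from : ∀ {P Q} → O Q ≐ O P ∘ from → IsAutotopism Θ P → IsAutotopism Θ′ Q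
  IsAutotopism-∘from {P} {Q} Q≐P∘from aut = IsAutotopismOf⇒IsAutotopism {Θ = Θ′} {P = Q}
    (IsAutotopismOf-resp-≐ {Θ = Θ′} {R = O P ∘ from} {O Q} (≐-sym Q≐P∘from)
      (IsAutotopismOf-∘from (IsAutotopism⇒IsAutotopismOf {Θ = Θ} {P = P} aut)))

  transport-InC : ∀ {P} → InC Θ P → InC Θ′ (transport S P)
  transport-InC {P} (isPLS , (r , c , s , x) , aut , (L , isLatin , autL , P⊆L)) =
    IsPartialLatin⇒IsPartialLatinSquare {P = transport S P} (transport-partialLatin S {P} pl) ,
    (_ , _ , _ , proj₂ O≐ (subst (O P) (sym (from∘to (r , c , s))) x)) ,
    IsAutotopism-∘from {P} {transport S P} O≐ aut ,
    (L′ , isLatin′ , IsAutotopism-∘from {asArray L} {asArray L′} L′≐L∘from autL ,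
     λ r c s y → proj₂ L′≐L∘from (P⊆L _ _ _ (proj₁ O≐ y)))
    where
    pl = IsPartialLatinSquare⇒IsPartialLatin {P = P} isPLS
    O≐ = O-transport S {P} pl
    completion = transport-completion S {L} isLatin
    L′ = proj₁ completion
    isLatin′ = proj₁ (proj₂ completion)
    L′≐L∘from = proj₂ (proj₂ completion)

record _≃ᶜ_ {n} (Θ Θ′ : Isotopism n) : Set where
  constructor mk≃ᶜ
  field
    sized : ∀ s → C[ Θ , s ] ↔ C[ Θ′ , s ]
    whole : C Θ ↔ C Θ′

≃ᶜ-trans : ∀ {n} {Θ Θ′ Θ″ : Isotopism n} → Θ ≃ᶜ Θ′ → Θ′ ≃ᶜ Θ″ → Θ ≃ᶜ Θ″
≃ᶜ-trans (mk≃ᶜ sized whole) (mk≃ᶜ sized′ whole′) =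
  mk≃ᶜ (λ s → ↔-trans (sized s) (sized′ s)) (↔-trans whole whole′)

_≟ₐ_ : ∀ {n} (P Q : Array n) → Dec (P ≡ Q)
_≟ₐ_ = Vec.≡-dec (Vec.≡-dec (Maybe.≡-dec Fin._≟_))

-- The proofs inside a refinement are irrelevant, so round-trip equalities are recomputed by deciding equality of arrays.
refinement-↔ : ∀ {n} {Q Q′ : Array n → Set} (f g : Array n → Array n) →
  (∀ {P} → Q P → Q′ (f P)) → (∀ {P} → Q′ P → Q (g P)) →
  (∀ {P} → Q′ P → f (g P) ≡ P) → (∀ {P} → Q P → g (f P) ≡ P) →
  Refinement (Array n) Q ↔ Refinement (Array n) Q′
refinement-↔ f g f-Q g-Q f∘g g∘f = mk↔ₛ′
  (λ { (P , [ q ]) → f P , [ f-Q q ] })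
  (λ { (P , [ q ]) → g P , [ g-Q q ] })
  (λ { (P , [ q ]) → value-injective (recompute (f (g P) ≟ₐ P) (f∘g q)) })
  (λ { (P , [ q ]) → value-injective (recompute (g (f P) ≟ₐ P) (g∘f q)) })

module _ {n : ℕ} (S : LatinSymmetry n) {Θ Θ′ : Isotopism n}
         (intertwines : ∀ t → act Θ′ (LatinSymmetry.to S t) ≡ LatinSymmetry.to S (act Θ t)) where
  private
    S⁻¹ : LatinSymmetry n
    S⁻¹ = LatinSymmetry.inverse S

    partial : ∀ {Θ : Isotopism n} P → InC Θ P → IsPartialLatin (O P)
    partial P inC = IsPartialLatinSquare⇒IsPartialLatin {P = P} (proj₁ inC)

    forth : ∀ {P} → InC Θ P → InC Θ′ (transport S P)
    forth {P} = transport-InC S {Θ} {Θ′} intertwines {P}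

    back : ∀ {P} → InC Θ′ P → InC Θ (transport S⁻¹ P)
    back {P} = transport-InC S⁻¹ {Θ′} {Θ} (from-intertwines S {Θ} {Θ′} intertwines) {P}

    back∘forth : ∀ {P} → InC Θ P → transport S⁻¹ (transport S P) ≡ P
    back∘forth {P} inC = transport-inverse S {P} (partial {Θ} P inC)

    forth∘back : ∀ {P} → InC Θ′ P → transport S (transport S⁻¹ P) ≡ P
    forth∘back {P} inC = transport-inverse S⁻¹ {P} (partial {Θ′} P inC)

  symmetry⇒≃ᶜ : Θ ≃ᶜ Θ′
  symmetry⇒≃ᶜ = mk≃ᶜ sized $ refinement-↔ {Q = InC Θ} {InC Θ′} (transport S) (transport S⁻¹)
    (λ {P} → forth {P}) (λ {P} → back {P}) (λ {P} → forth∘back {P}) (λ {P} → back∘forth {P})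
    where
    sized : ∀ s → C[ Θ , s ] ↔ C[ Θ′ , s ]
    sized s = refinement-↔ {Q = λ P → InC Θ P × size P ≡ s} {λ P → InC Θ′ P × size P ≡ s}
      (transport S) (transport S⁻¹)
      (λ {P} (inC , size≡s) → forth {P} inC , trans (size-transport S {P} (partial {Θ} P inC)) size≡s)
      (λ {P} (inC , size≡s) → back {P} inC , trans (size-transport S⁻¹ {P} (partial {Θ′} P inC)) size≡s)
      (λ {P} → forth∘back {P} ∘ proj₁) (λ {P} → back∘forth {P} ∘ proj₁)

-- Parastrophes and isotopisms

module _ {n : ℕ} where
  swap₁₂ swap₂₃ : Triple n → Triple n
  swap₁₂ (r , c , s) = c , r , s
  swap₂₃ (r , c , s) = r , s , c

  swap₁₂-preserves : PreservesLatin swap₁₂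
  swap₁₂-preserves = record
    { partialLatin = partialLatin
    ; latin = λ lat → record
        { isPartialLatin = partialLatin (IsLatin.isPartialLatin lat)
        ; symbol-exists  = λ r c → IsLatin.symbol-exists lat c r
        ; column-exists  = IsLatin.row-exists lat
        ; row-exists     = IsLatin.column-exists lat
        }
    ; sum³-∘ = λ g → ∑-comm (λ r c → sum λ s → g (c , r , s))
    }
    where
    partialLatin : ∀ {R} → IsPartialLatin R → IsPartialLatin (R ∘ swap₁₂)
    partialLatin pl = record { symbol-unique = symbol-unique ; column-unique = row-unique ; row-unique = column-unique }
      where open IsPartialLatin pl

  swap₂₃-preserves : PreservesLatin swap₂₃
  swap₂₃-preserves = record
    { partialLatin = partialLatin
    ; latin = λ lat → record
        { isPartialLatin = partialLatin (IsLatin.isPartialLatin lat)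
        ; symbol-exists  = IsLatin.column-exists lat
        ; column-exists  = IsLatin.symbol-exists lat
        ; row-exists     = λ c s → IsLatin.row-exists lat s c
        }
    ; sum³-∘ = λ g → sum-cong-≗ λ r → ∑-comm (λ c s → g (r , s , c))
    }
    where
    partialLatin : ∀ {R} → IsPartialLatin R → IsPartialLatin (R ∘ swap₂₃)
    partialLatin pl = record { symbol-unique = column-unique ; column-unique = symbol-unique ; row-unique = row-unique }
      where open IsPartialLatin pl

  involution : (φ : Triple n → Triple n) → (∀ t → φ (φ t) ≡ t) → PreservesLatin φ → LatinSymmetry n
  involution φ φ∘φ preserves = record
    { to = φ ; from = φ ; to∘from = φ∘φ ; from∘to = φ∘φ ; to-preserves = preserves ; from-preserves = preserves }

  ≃ᶜ-swap₁₂ : ∀ (α β γ : Permutation′ n) → (α , β , γ) ≃ᶜ (β , α , γ)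
  ≃ᶜ-swap₁₂ α β γ =
    symmetry⇒≃ᶜ (involution swap₁₂ (λ _ → refl) swap₁₂-preserves) {α , β , γ} {β , α , γ} (λ _ → refl)

  ≃ᶜ-swap₂₃ : ∀ (α β γ : Permutation′ n) → (α , β , γ) ≃ᶜ (α , γ , β)
  ≃ᶜ-swap₂₃ α β γ =
    symmetry⇒≃ᶜ (involution swap₂₃ (λ _ → refl) swap₂₃-preserves) {α , β , γ} {α , γ , β} (λ _ → refl)

  act-preserves : (Θ : Isotopism n) → PreservesLatin (act Θ)
  act-preserves (α , β , γ) = record
    { partialLatin = partialLatin
    ; latin = λ {R} lat → record
        { isPartialLatin = partialLatin (IsLatin.isPartialLatin lat)
        ; symbol-exists = λ r c → let s , x = IsLatin.symbol-exists lat (α ⟨$⟩ʳ r) (β ⟨$⟩ʳ c) in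
            γ ⟨$⟩ˡ s , subst (λ s → R (α ⟨$⟩ʳ r , β ⟨$⟩ʳ c , s)) (sym (inverseʳ γ)) x
        ; column-exists = λ r s → let c , x = IsLatin.column-exists lat (α ⟨$⟩ʳ r) (γ ⟨$⟩ʳ s) in
            β ⟨$⟩ˡ c , subst (λ c → R (α ⟨$⟩ʳ r , c , γ ⟨$⟩ʳ s)) (sym (inverseʳ β)) x
        ; row-exists = λ c s → let r , x = IsLatin.row-exists lat (β ⟨$⟩ʳ c) (γ ⟨$⟩ʳ s) in
            α ⟨$⟩ˡ r , subst (λ r → R (r , β ⟨$⟩ʳ c , γ ⟨$⟩ʳ s)) (sym (inverseʳ α)) x
        }
    ; sum³-∘ = λ g → begin
        (sum λ r → sum λ c → sum λ s → g (α ⟨$⟩ʳ r , β ⟨$⟩ʳ c , γ ⟨$⟩ʳ s))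
          ≡⟨ sum-cong-≗ (λ r → sum-cong-≗ λ c → ∑-permute (λ s → g (α ⟨$⟩ʳ r , β ⟨$⟩ʳ c , s)) γ) ⟨
        (sum λ r → sum λ c → sum λ s → g (α ⟨$⟩ʳ r , β ⟨$⟩ʳ c , s))
          ≡⟨ sum-cong-≗ (λ r → ∑-permute (λ c → sum λ s → g (α ⟨$⟩ʳ r , c , s)) β) ⟨
        (sum λ r → sum λ c → sum λ s → g (α ⟨$⟩ʳ r , c , s))
          ≡⟨ ∑-permute (λ r → sum λ c → sum λ s → g (r , c , s)) α ⟨
        (sum λ r → sum λ c → sum λ s → g (r , c , s)) ∎
    }
    where
    open ≡-Reasoning
    partialLatin : ∀ {R} → IsPartialLatin R → IsPartialLatin (R ∘ act (α , β , γ))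
    partialLatin pl = record
      { symbol-unique = λ x y → Cycles.f-injective γ (symbol-unique x y)
      ; column-unique = λ x y → Cycles.f-injective β (column-unique x y)
      ; row-unique    = λ x y → Cycles.f-injective α (row-unique x y)
      }
      where open IsPartialLatin pl

  isotopy : Isotopism n → LatinSymmetry n
  isotopy (α , β , γ) = record
    { to = act (α , β , γ) ; from = act (flip α , flip β , flip γ)
    ; to∘from = λ _ → cong₂ _,_ (inverseʳ α) (cong₂ _,_ (inverseʳ β) (inverseʳ γ))
    ; from∘to = λ _ → cong₂ _,_ (inverseˡ α) (cong₂ _,_ (inverseˡ β) (inverseˡ γ))
    ; to-preserves = act-preserves (α , β , γ) ; from-preserves = act-preserves (flip α , flip β , flip γ)
    }

≃ᶜ-refl : ∀ {n} (Θ : Isotopism n) → Θ ≃ᶜ Θ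
≃ᶜ-refl _ = mk≃ᶜ (λ _ → ↔-refl) ↔-refl

≃ᶜ-CycleStructure : ∀ {n} {α β γ α′ β′ γ′ : Permutation′ n} →
  CycleStructure α ≡ CycleStructure α′ → CycleStructure β ≡ CycleStructure β′ →
  CycleStructure γ ≡ CycleStructure γ′ →
  (α , β , γ) ≃ᶜ (α′ , β′ , γ′)
≃ᶜ-CycleStructure {α = α} {β} {γ} {α′} {β′} {γ′} α≈α′ β≈β′ γ≈γ′
  with conjugate α α′ α≈α′ | conjugate β β′ β≈β′ | conjugate γ γ′ γ≈γ′
... | σ₁ , σ₁α≡α′σ₁ | σ₂ , σ₂β≡β′σ₂ | σ₃ , σ₃γ≡γ′σ₃ =
  symmetry⇒≃ᶜ (isotopy (σ₁ , σ₂ , σ₃)) {α , β , γ} {α′ , β′ , γ′}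
    λ (r , c , s) → sym (cong₂ _,_ (σ₁α≡α′σ₁ r) (cong₂ _,_ (σ₂β≡β′σ₂ c) (σ₃γ≡γ′σ₃ s)))

arrangements : List.List (Fin 3 × Fin 3 × Fin 3)
arrangements = (0F , 1F , 2F) List.∷ (0F , 2F , 1F) List.∷ (1F , 0F , 2F) List.∷
               (1F , 2F , 0F) List.∷ (2F , 0F , 1F) List.∷ (2F , 1F , 0F) List.∷ List.[]

distinct⇒arrangement : ∀ a b c → a ≢ b → a ≢ c → b ≢ c → (a , b , c) ∈ arrangements
distinct⇒arrangement = from-yes (all? λ a → all? λ b → all? λ c →
  ¬? (a Fin.≟ b) →-dec ¬? (a Fin.≟ c) →-dec ¬? (b Fin.≟ c) →-dec ((a , b , c) ∈? arrangements))

≃ᶜ-arrangement : ∀ {n} (Θ : Isotopism n) {a b c} → (a , b , c) ∈ arrangements →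
  (component Θ a , component Θ b , component Θ c) ≃ᶜ Θ
≃ᶜ-arrangement (α , β , γ) (here refl) = ≃ᶜ-refl (α , β , γ)
≃ᶜ-arrangement (α , β , γ) (there (here refl)) = ≃ᶜ-swap₂₃ α γ β
≃ᶜ-arrangement (α , β , γ) (there (there (here refl))) = ≃ᶜ-swap₁₂ β α γ
≃ᶜ-arrangement (α , β , γ) (there (there (there (here refl)))) =
  ≃ᶜ-trans (≃ᶜ-swap₂₃ β γ α) (≃ᶜ-swap₁₂ β α γ)
≃ᶜ-arrangement (α , β , γ) (there (there (there (there (here refl))))) =
  ≃ᶜ-trans (≃ᶜ-swap₁₂ γ α β) (≃ᶜ-swap₂₃ α γ β)
≃ᶜ-arrangement (α , β , γ) (there (there (there (there (there (here refl)))))) =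
  ≃ᶜ-trans (≃ᶜ-swap₁₂ γ β α) (≃ᶜ-trans (≃ᶜ-swap₂₃ β γ α) (≃ᶜ-swap₁₂ β α γ))

lemma17 : ∀ {n : ℕ} (Θ₁ Θ₂ : Isotopism n) → CycleStructurePermuted Θ₁ Θ₂ →
    ((s : ℕ) → 1 ≤ s → s ≤ n * n → C[ Θ₁ , s ] ↔ C[ Θ₂ , s ]) × (C Θ₁ ↔ C Θ₂)
lemma17 (α , β , γ) Θ₂ (σ , same) = (λ s _ _ → _≃ᶜ_.sized Θ₁≃ᶜΘ₂ s) , _≃ᶜ_.whole Θ₁≃ᶜΘ₂
  where
  distinct : ∀ {i j} → i ≢ j → σ ⟨$⟩ʳ i ≢ σ ⟨$⟩ʳ j
  distinct i≢j = i≢j ∘ Cycles.f-injective σ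
  Θ₁≃ᶜΘ₂ : (α , β , γ) ≃ᶜ Θ₂
  Θ₁≃ᶜΘ₂ = ≃ᶜ-trans (≃ᶜ-CycleStructure {α = α} {β} {γ} (same 0F) (same 1F) (same 2F))
    (≃ᶜ-arrangement Θ₂ (distinct⇒arrangement _ _ _ (distinct λ ()) (distinct λ ()) (distinct λ ())))
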